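{- Let $p$ be a prime and let $n$ be a positive integer divisible by $p^3$. Let $R$ be an $n\times n$ array of integers possessing the $p\times p$ property. Then $\theta(R)$ possesses the $p\times p$ property.
   Context: Rows and columns of an $n\times n$ array are indexed $0,\dots,n-1$, with indices read modulo $n$ (toric wraparound) where needed. An $n\times n$ array has the $p\times p$ property if the entries of every $p\times p$ subsquare formed from $p$ consecutive rows and $p$ consecutive columns (allowing toric wraparound) sum to $\frac{p^2(n^2-1)}{2}$. The map $\theta$ (which depends on $p$) is defined on $n\times n$ arrays with $p^2\mid n$ as follows: view $R$ as a $p^2\times p^2$ block array $R=(R_{i,j})_{0\le i,j\le p^2-1}$, where each block $R_{i,j}$ is the $\frac{n}{p^2}\times\frac{n}{p^2}$ subarray in block-row $i$ and block-column $j$. For $i=\ell p+m$ with $\ell,m\in\{0,\dots,p-1\}$ put $\bar i=mp+\ell$. Then $\theta(R)$ is the $n\times n$ array whose $(i,j)$ block is $[\theta(R)]_{i,j}=R_{\bar i,\bar j}$. -}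

module Defs where

open import Data.Nat using (ℕ; zero; suc; _+_; _*_; NonZero)
open import Data.Nat.DivMod using (_/_; _%_; _mod_)
open import Data.Fin using (Fin; toℕ)
open import Data.Integer using (ℤ; +_; _-_)
import Data.Integer as ℤ

Array : ℕ → Set
Array n = Fin n → Fin n → ℤ

Σ< : ℕ → (ℕ → ℤ) → ℤ
Σ< zero    f = + 0
Σ< (suc k) f = Σ< k f ℤ.+ f k

entry : (n : ℕ) → .{{_ : NonZero n}} → Array n → ℕ → ℕ → ℤ
entry n R i j = R (i mod n) (j mod n)

subsquareSum : (n : ℕ) → .{{_ : NonZero n}} → (p : ℕ) → Array n → Fin n → Fin n → ℤ
subsquareSum n p R i j =
  Σ< p (λ a → Σ< p (λ b → entry n R (toℕ i + a) (toℕ j + b)))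

-- The p×p property: every p×p subsquare sums to p²(n²-1)/2.
-- Stated without division: 2 · (subsquare sum) = p²(n²-1), which is
-- equivalent (over the rationals) to the sum equalling p²(n²-1)/2.
HasPProperty : (n : ℕ) → .{{_ : NonZero n}} → (p : ℕ) → Array n → Set
HasPProperty n p R =
  ∀ (i j : Fin n) →
    + 2 ℤ.* subsquareSum n p R i j ≡ (+ (p * p)) ℤ.* ((+ (n * n)) - + 1)
  where open import Relation.Binary.PropositionalEquality using (_≡_)

barIdx : (p : ℕ) → .{{_ : NonZero p}} → ℕ → ℕ
barIdx p q = (q % p) * p + q / p

θIdx : (p b : ℕ) → .{{_ : NonZero p}} → .{{_ : NonZero b}} → ℕ → ℕ
θIdx p b i = barIdx p (i / b) * b + i % b

-- θ on n×n arrays with n = p²·b (b = n / p² the block size):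
-- [θ(R)]_{i,j} block = R_{bar i, bar j} block.
-- (Only meaningful when p² ∣ n; the statement supplies p³ ∣ n.)
θ : (n p : ℕ) → .{{_ : NonZero n}} → .{{_ : NonZero p}} →
    .{{_ : NonZero (p * p)}} → .{{_ : NonZero (n / (p * p))}} →
    Array n → Array n
θ n p R i j =
  entry n R (θIdx p (n / (p * p)) (toℕ i)) (θIdx p (n / (p * p)) (toℕ j))

-- Differencing two adjacent windows shows that an integer sequence whose
-- length-p window sums are all equal to C is p-periodic, so any p terms taken
-- at a complete system of residues mod p also sum to C. Applying this in both
-- coordinates, any p × p "square" of entries whose row and column indices run
-- through complete residue systems mod p sums to the common subsquare sum.
-- When p³ ∣ n the block size n/p² is a multiple of p, so θ permutes whole
-- blocks of length divisible by p and preserves every index mod p: each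
-- subsquare of θ(R) is such a residue-complete square of R.
module Submission where

open import Defs
open import Data.Nat using (ℕ; _*_; NonZero)
open import Data.Nat.Divisibility using (_∣_)
open import Data.Nat.Primality using (Prime)
open import Data.Nat.DivMod using (_/_)

open import Data.Nat using (zero; suc; _+_; _%_)
import Data.Nat.Properties as ℕ
open import Data.Nat.DivMod
  using (_mod_; m≡m%n+[m/n]*n; %-distribˡ-+; m%n%n≡m%n; %-remove-+ˡ; m∣n⇒o%n%m≡o%m)
open import Data.Nat.Divisibility using (∣-trans; n∣m*n; m*n∣⇒n∣; m*n∣o⇒m∣o/n)
open import Data.Fin using (Fin; toℕ)
open import Data.Fin.Properties using (toℕ-fromℕ<; toℕ-injective)
open import Data.Integer using (ℤ; +_)
import Data.Integer as ℤ
import Data.Integer.Properties as ℤ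
open import Algebra.Bundles using (AbelianGroup)
open import Algebra.Properties.Group (AbelianGroup.group ℤ.+-0-abelianGroup) using (∙-cancelˡ)
open import Algebra.Properties.CommutativeSemigroup ℤ.+-commutativeSemigroup
  using (interchange)
open import Relation.Binary.PropositionalEquality
open ≡-Reasoning

Σ<-cong : ∀ k {f g : ℕ → ℤ} → (∀ a → f a ≡ g a) → Σ< k f ≡ Σ< k g
Σ<-cong zero    f≗g = refl
Σ<-cong (suc k) f≗g = cong₂ ℤ._+_ (Σ<-cong k f≗g) (f≗g k)

Σ<-zero : ∀ k → Σ< k (λ _ → + 0) ≡ + 0
Σ<-zero zero    = refl
Σ<-zero (suc k) = cong (ℤ._+ + 0) (Σ<-zero k)

Σ<-suc : ∀ k (f : ℕ → ℤ) → Σ< (suc k) f ≡ f 0 ℤ.+ Σ< k (λ a → f (suc a))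
Σ<-suc zero    f = ℤ.+-comm (+ 0) (f 0)
Σ<-suc (suc k) f = begin
  Σ< (suc k) f ℤ.+ f (suc k)                          ≡⟨ cong (ℤ._+ f (suc k)) (Σ<-suc k f) ⟩
  f 0 ℤ.+ Σ< k (λ a → f (suc a)) ℤ.+ f (suc k)        ≡⟨ ℤ.+-assoc (f 0) _ (f (suc k)) ⟩
  f 0 ℤ.+ (Σ< k (λ a → f (suc a)) ℤ.+ f (suc k))      ∎

Σ<-+ : ∀ k (f g : ℕ → ℤ) → Σ< k (λ a → f a ℤ.+ g a) ≡ Σ< k f ℤ.+ Σ< k g
Σ<-+ zero    f g = refl
Σ<-+ (suc k) f g = trans (cong (ℤ._+ (f k ℤ.+ g k)) (Σ<-+ k f g))
                         (interchange (Σ< k f) (Σ< k g) (f k) (g k))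

Σ<-swap : ∀ m k (f : ℕ → ℕ → ℤ) →
          Σ< m (λ a → Σ< k (f a)) ≡ Σ< k (λ b → Σ< m (λ a → f a b))
Σ<-swap zero    k f = sym (Σ<-zero k)
Σ<-swap (suc m) k f = trans (cong (ℤ._+ Σ< k (f m)) (Σ<-swap m k f))
                            (sym (Σ<-+ k (λ b → Σ< m (λ a → f a b)) (f m)))

module ConstantWindowSums (p : ℕ) .{{_ : NonZero p}} (g : ℕ → ℤ) (C : ℤ)
         (windowSum≡C : ∀ j → Σ< p (λ b → g (j + b)) ≡ C) where

  -- Both sides equal the sum over the window of length p + 1 starting at j.
  periodic : ∀ j → g (j + p) ≡ g j
  periodic j = ∙-cancelˡ C (g (j + p)) (g j) (begin
    C ℤ.+ g (j + p)                       ≡⟨ cong (ℤ._+ g (j + p)) (windowSum≡C j) ⟨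
    Σ< (suc p) (λ b → g (j + b))          ≡⟨ Σ<-suc p (λ b → g (j + b)) ⟩
    g (j + 0) ℤ.+ Σ< p (λ b → g (j + suc b))
      ≡⟨ cong₂ ℤ._+_ (cong g (ℕ.+-identityʳ j)) (Σ<-cong p (λ b → cong g (ℕ.+-suc j b))) ⟩
    g j ℤ.+ Σ< p (λ b → g (suc j + b))    ≡⟨ cong (ℤ._+_ (g j)) (windowSum≡C (suc j)) ⟩
    g j ℤ.+ C                             ≡⟨ ℤ.+-comm (g j) C ⟩
    C ℤ.+ g j                             ∎)

  periodic-* : ∀ r k → g (r + k * p) ≡ g r
  periodic-* r zero    = cong g (ℕ.+-identityʳ r)
  periodic-* r (suc k) = begin
    g (r + (p + k * p))  ≡⟨ cong g (trans (cong (_+_ r) (ℕ.+-comm p (k * p))) (sym (ℕ.+-assoc r (k * p) p))) ⟩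
    g (r + k * p + p)    ≡⟨ periodic (r + k * p) ⟩
    g (r + k * p)        ≡⟨ periodic-* r k ⟩
    g r                  ∎

  periodic-% : ∀ x → g x ≡ g (x % p)
  periodic-% x = trans (cong g (m≡m%n+[m/n]*n x p)) (periodic-* (x % p) (x / p))

  sum-over-residues : ∀ (y : ℕ → ℕ) j → (∀ b → y b % p ≡ (j + b) % p) →
                      Σ< p (λ b → g (y b)) ≡ C
  sum-over-residues y j y≡j+ = trans
    (Σ<-cong p (λ b → trans (periodic-% (y b))
                     (trans (cong g (y≡j+ b)) (sym (periodic-% (j + b))))))
    (windowSum≡C j)

squareSum-over-residues :
  ∀ p .{{_ : NonZero p}} (G : ℕ → ℕ → ℤ) (C : ℤ) →
  (∀ i j → Σ< p (λ a → Σ< p (λ b → G (i + a) (j + b))) ≡ C) →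
  ∀ (x y : ℕ → ℕ) i j →
  (∀ a → x a % p ≡ (i + a) % p) → (∀ b → y b % p ≡ (j + b) % p) →
  Σ< p (λ a → Σ< p (λ b → G (x a) (y b))) ≡ C
squareSum-over-residues p G C squareSum≡C x y i j x≡i+ y≡j+ =
  trans (Σ<-swap p p (λ a b → G (x a) (y b)))
        (ConstantWindowSums.sum-over-residues p (λ c → Σ< p (λ a → G (x a) c)) C
           columnWindowSum≡C y j y≡j+)
  where
  columnWindowSum≡C : ∀ j′ → Σ< p (λ b → Σ< p (λ a → G (x a) (j′ + b))) ≡ C
  columnWindowSum≡C j′ = trans (sym (Σ<-swap p p (λ a b → G (x a) (j′ + b))))
    (ConstantWindowSums.sum-over-residues p (λ r → Σ< p (λ b → G r (j′ + b))) C
       (λ i′ → squareSum≡C i′ j′) x i x≡i+)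

toℕ-mod : ∀ m n .{{_ : NonZero n}} → toℕ (m mod n) ≡ m % n
toℕ-mod m n = toℕ-fromℕ< _

toℕ-mod-+-mod : ∀ i a n .{{_ : NonZero n}} → (toℕ (i mod n) + a) mod n ≡ (i + a) mod n
toℕ-mod-+-mod i a n = toℕ-injective (begin
  toℕ ((toℕ (i mod n) + a) mod n)  ≡⟨ toℕ-mod _ n ⟩
  (toℕ (i mod n) + a) % n          ≡⟨ cong (λ z → (z + a) % n) (toℕ-mod i n) ⟩
  (i % n + a) % n                  ≡⟨ %-distribˡ-+ (i % n) a n ⟩
  (i % n % n + a % n) % n          ≡⟨ cong (λ z → (z + a % n) % n) (m%n%n≡m%n i n) ⟩
  (i % n + a % n) % n              ≡⟨ %-distribˡ-+ i a n ⟨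
  (i + a) % n                      ≡⟨ toℕ-mod _ n ⟨
  toℕ ((i + a) mod n)              ∎)

toricSquareSum : (n : ℕ) → .{{_ : NonZero n}} → (p : ℕ) → Array n → ℕ → ℕ → ℤ
toricSquareSum n p R i j = Σ< p (λ a → Σ< p (λ b → entry n R (i + a) (j + b)))

subsquareSum≡toricSquareSum : ∀ n .{{_ : NonZero n}} p (R : Array n) i j →
  subsquareSum n p R (i mod n) (j mod n) ≡ toricSquareSum n p R i j
subsquareSum≡toricSquareSum n p R i j = Σ<-cong p (λ a → Σ<-cong p (λ b →
  cong₂ R (toℕ-mod-+-mod i a n) (toℕ-mod-+-mod j b n)))

toricSquareSum-constant : ∀ n .{{_ : NonZero n}} p (R : Array n) → HasPProperty n p R →
  ∀ i j → toricSquareSum n p R i j ≡ subsquareSum n p R (0 mod n) (0 mod n)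
toricSquareSum-constant n p R hasP i j = begin
  toricSquareSum n p R i j                ≡⟨ subsquareSum≡toricSquareSum n p R i j ⟨
  subsquareSum n p R (i mod n) (j mod n)  ≡⟨ ℤ.*-cancelˡ-≡ (+ 2) _ _
                                               (trans (hasP _ _) (sym (hasP _ _))) ⟩
  subsquareSum n p R (0 mod n) (0 mod n)  ∎

θIdx-% : ∀ p b .{{_ : NonZero p}} .{{_ : NonZero b}} i → p ∣ b → θIdx p b i % p ≡ i % p
θIdx-% p b i p∣b = begin
  (barIdx p (i / b) * b + i % b) % p  ≡⟨ %-remove-+ˡ (i % b) (∣-trans p∣b (n∣m*n (barIdx p (i / b)))) ⟩
  i % b % p                           ≡⟨ m∣n⇒o%n%m≡o%m p b i p∣b ⟩
  i % p                               ∎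

θIdx-toric-% : ∀ n p .{{_ : NonZero n}} .{{_ : NonZero p}} .{{_ : NonZero (p * p)}}
  .{{_ : NonZero (n / (p * p))}} → p * p * p ∣ n →
  ∀ m → θIdx p (n / (p * p)) (toℕ (m mod n)) % p ≡ m % p
θIdx-toric-% n p p³∣n m = begin
  θIdx p (n / (p * p)) (toℕ (m mod n)) % p  ≡⟨ θIdx-% p _ (toℕ (m mod n)) p∣blockSize ⟩
  toℕ (m mod n) % p                         ≡⟨ cong (_% p) (toℕ-mod m n) ⟩
  m % n % p                                 ≡⟨ m∣n⇒o%n%m≡o%m p n m (m*n∣⇒n∣ (p * p) p p³∣n) ⟩
  m % p                                     ∎
  where
  p∣blockSize : p ∣ n / (p * p)
  p∣blockSize = m*n∣o⇒m∣o/n p (p * p) (subst (_∣ n) (ℕ.*-comm (p * p) p) p³∣n)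

proposition2p1 : (p n : ℕ) → Prime p → .{{_ : NonZero n}} → .{{_ : NonZero p}}
                 → .{{_ : NonZero (p * p)}} → .{{_ : NonZero (n / (p * p))}}
                 → (p * p * p) ∣ n → (R : Array n)
                 → HasPProperty n p R → HasPProperty n p (θ n p R)
proposition2p1 p n _ p³∣n R hasP i j = begin
  + 2 ℤ.* subsquareSum n p (θ n p R) i j        ≡⟨ cong (+ 2 ℤ.*_) θSubsquare≡C ⟩
  + 2 ℤ.* subsquareSum n p R (0 mod n) (0 mod n) ≡⟨ hasP _ _ ⟩
  + (p * p) ℤ.* (+ (n * n) ℤ.- + 1)             ∎
  where
  θIdx-toric : ℕ → ℕ
  θIdx-toric m = θIdx p (n / (p * p)) (toℕ (m mod n))

  θSubsquare≡C : subsquareSum n p (θ n p R) i j ≡ subsquareSum n p R (0 mod n) (0 mod n)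
  θSubsquare≡C = squareSum-over-residues p (entry n R) _ (toricSquareSum-constant n p R hasP)
    (λ a → θIdx-toric (toℕ i + a)) (λ b → θIdx-toric (toℕ j + b)) (toℕ i) (toℕ j)
    (λ a → θIdx-toric-% n p p³∣n (toℕ i + a)) (λ b → θIdx-toric-% n p p³∣n (toℕ j + b))
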